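{- Let $G=(V,E)$ be a finite, undirected, unweighted, simple, connected graph with $N=|V|$ nodes, and let $d_1\ge d_2\ge\dots\ge d_N$ be its degree sequence listed in non-increasing order. Let $n_1\in\{0,1,\dots,N\}$, and let each node $i$ carry a binary characteristic $c_i\in\{0,1\}$ such that exactly $n_1$ nodes have $c_i=1$. Let $m_{10}$ denote the number of edges with one endpoint of characteristic $1$ and the other of characteristic $0$. Then $m_{10}\ge LBm_{10}$, where $$LBm_{10}=\begin{cases}0 & \text{if } n_1\in\{0,N\},\\[2pt] \max\Big(1,\ \sum_{i=N-n_1+1}^{N} d_i-n_1(n_1-1)\Big) & \text{if } 0<n_1<N.\end{cases}$$
   Context: The degree $d_i$ of a node is the number of edges incident to it. $\sum_{i=N-n_1+1}^{N} d_i$ is the sum of the $n_1$ smallest degrees (the "tail" of length $n_1$ of the non-increasingly ordered degree sequence). -}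

module Defs where

open import Data.Bool using (Bool; true; false; if_then_else_; _xor_)
open import Data.Nat using (ℕ; zero; suc; _+_; _*_; _∸_; _⊔_; _<_)
open import Data.Nat.Properties using (≤-decTotalOrder)
open import Data.Fin using (Fin; toℕ)
open import Data.List using (List; take; map; allFin)
open import Data.Nat.ListAction using (sum)
open import Data.List.Sort ≤-decTotalOrder using (sort)
open import Relation.Binary.PropositionalEquality using (_≡_)

record SimpleGraph (N : ℕ) : Set where
  field
    adj   : Fin N → Fin N → Bool
    sym   : ∀ i j → adj i j ≡ adj j i
    irrefl : ∀ i → adj i i ≡ false
open SimpleGraph public

count : ∀ {n} → (Fin n → Bool) → ℕ
count {zero}  P = 0
count {suc n} P = (if P Fin.zero then 1 else 0) + count {n} (λ i → P (Fin.suc i))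

sumFin : ∀ {n} → (Fin n → ℕ) → ℕ
sumFin {zero}  f = 0
sumFin {suc n} f = f Fin.zero + sumFin {n} (λ i → f (Fin.suc i))

data Reachable {N : ℕ} (G : SimpleGraph N) : Fin N → Fin N → Set where
  here : ∀ {i} → Reachable G i i
  step : ∀ {i j k} → adj G i j ≡ true → Reachable G j k → Reachable G i k

Connected : ∀ {N} → SimpleGraph N → Set
Connected G = ∀ i j → Reachable G i j

degree : ∀ {N} → SimpleGraph N → Fin N → ℕ
degree G i = count (adj G i)

degrees : ∀ {N} → SimpleGraph N → List ℕ
degrees G = map (degree G) (allFin _)

-- Sum of the n₁ smallest degrees, i.e. Σ_{i=N-n₁+1}^{N} d_i for the
-- non-increasingly ordered sequence d_1 ≥ … ≥ d_N
-- (= first n₁ entries of the non-decreasingly sorted list).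
sumSmallestDegrees : ∀ {N} → SimpleGraph N → ℕ → ℕ
sumSmallestDegrees G n₁ = sum (take n₁ (sort (degrees G)))

-- m₁₀: number of edges {i,j} (counted once, via i < j) whose endpoints
-- have different characteristic.
m10 : ∀ {N} → SimpleGraph N → (Fin N → Bool) → ℕ
m10 G c = sumFin (λ i → count (λ j →
  if toℕ i Data.Nat.<ᵇ toℕ j then (adj G i j Data.Bool.∧ (c i xor c j)) else false))

-- The lower bound LBm₁₀ (in the case 0 < n₁ < N; ∸ is truncated
-- subtraction, which is harmless inside max(1, ·)).
LBm10 : ∀ {N} → SimpleGraph N → ℕ → ℕ
LBm10 {N} G zero = 0
LBm10 {N} G n₁@(suc _) with N Data.Nat.≤ᵇ n₁
... | true  = 0
... | false = 1 ⊔ (sumSmallestDegrees G n₁ ∸ n₁ * (n₁ ∸ 1))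

-- The n₁ nodes of characteristic 1 have total degree at least the sum of the
-- n₁ smallest degrees. Splitting each such degree into neighbours of
-- characteristic 1 (at most n₁ − 1 of them, the graph being simple) and of
-- characteristic 0, the latter contributions add up exactly to m₁₀. When
-- 0 < n₁ < N, a path from a 1-node to a 0-node must cross between the two
-- classes, so connectivity gives m₁₀ ≥ 1.
module Submission where

open import Defs hiding (sym)
open import Data.Bool using (Bool; true; false; if_then_else_; _xor_; _∧_; not; T)
open import Data.Bool.Properties using (∧-conicalʳ; xor-comm)
open import Data.Fin using (Fin; toℕ; zero; suc)
open import Data.Fin.Properties using (toℕ-injective)
open import Data.List using (List; []; _∷_; _++_; take; length; tabulate; map; allFin)
open import Data.List.Properties using (map-tabulate)
open import Data.List.Membership.Propositional using (_∈_)
open import Data.List.Membership.Propositional.Properties using (∈-∃++; ∈-++⁻; ∈-++⁺ʳ)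
open import Data.List.Relation.Binary.Permutation.Propositional using (_↭_; ↭-refl; ↭-sym; ↭-trans; prep)
open import Data.List.Relation.Binary.Permutation.Propositional.Properties
  using (∈-resp-↭; shift; drop-∷; ↭-length; ++⁺ˡ; ++⁺ʳ)
open import Data.List.Relation.Unary.All using () renaming (lookup to All-lookup)
open import Data.List.Relation.Unary.AllPairs using (AllPairs; _∷_)
open import Data.List.Relation.Unary.Any using (here)
open import Data.List.Relation.Unary.Linked.Properties using (Linked⇒AllPairs)
open import Data.Nat.Properties
open import Algebra.Properties.CommutativeSemigroup +-commutativeSemigroup
  using () renaming (interchange to +-interchange)
open import Data.List.Sort ≤-decTotalOrder using (sort; sort-↭; sort-↗)
open import Data.Nat using (ℕ; zero; suc; _+_; _*_; _∸_; _≤_; _<_; _≥_; z≤n; s≤s; _<ᵇ_; _≤ᵇ_)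
open import Data.Nat.ListAction using (sum)
open import Data.Nat.ListAction.Properties using (sum-↭)
open import Data.Product using (Σ; ∃; _×_; _,_)
open import Data.Sum using (inj₁; inj₂)
open import Function using (_∘_)
open import Relation.Binary.Definitions using (tri<; tri≈; tri>)
open import Relation.Binary.PropositionalEquality
  using (_≡_; refl; sym; trans; cong; cong₂; subst; module ≡-Reasoning)

∈⇒↭∷ : ∀ {x : ℕ} {ys} → x ∈ ys → ∃ λ ws → ys ↭ x ∷ ws
∈⇒↭∷ x∈ys with as , bs , refl ← ∈-∃++ x∈ys = as ++ bs , shift _ as bs

-- The head x of a sorted list is matched either by an element of ys (remove
-- both) or by one of zs, which is then exchanged for the first element y of
-- ys; in the latter case x ≤ y because y occurs later in the sorted list.
sum-take-sorted-≤ : ∀ {xs ys zs k} → AllPairs _≤_ xs → length ys ≡ k →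
                    xs ↭ ys ++ zs → sum (take k xs) ≤ sum ys
sum-take-sorted-≤ {k = zero} _ _ _ = z≤n
sum-take-sorted-≤ {[]} {k = suc _} _ _ _ = z≤n
sum-take-sorted-≤ {x ∷ xs} {[]} {k = suc _} _ () _
sum-take-sorted-≤ {x ∷ xs} {y ∷ ys} {zs} {suc k} (x≤xs ∷ xs↗) |ys| x∷xs↭
  with ∈-++⁻ (y ∷ ys) (∈-resp-↭ x∷xs↭ (here refl))
... | inj₁ x∈ys with ws , y∷ys↭x∷ws ← ∈⇒↭∷ x∈ys = begin
  x + sum (take k xs)  ≤⟨ +-monoʳ-≤ x (sum-take-sorted-≤ {ys = ws} xs↗ |ws| xs↭) ⟩
  x + sum ws           ≡⟨ sum-↭ y∷ys↭x∷ws ⟨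
  y + sum ys           ∎
  where
  open ≤-Reasoning
  |ws| : length ws ≡ k
  |ws| = suc-injective (trans (sym (↭-length y∷ys↭x∷ws)) |ys|)
  xs↭ : xs ↭ ws ++ zs
  xs↭ = drop-∷ (↭-trans x∷xs↭ (++⁺ʳ zs y∷ys↭x∷ws))
... | inj₂ x∈zs with ws , zs↭x∷ws ← ∈⇒↭∷ x∈zs =
  +-mono-≤ x≤y (sum-take-sorted-≤ {ys = ys} xs↗ (suc-injective |ys|) xs↭)
  where
  xs↭ : xs ↭ ys ++ y ∷ ws
  xs↭ = ↭-trans
    (drop-∷ (↭-trans x∷xs↭ (↭-trans (prep y (++⁺ˡ ys zs↭x∷ws)) (shift x (y ∷ ys) ws))))
    (↭-sym (shift y ys ws))
  x≤y : x ≤ y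
  x≤y = All-lookup x≤xs (∈-resp-↭ (↭-sym xs↭) (∈-++⁺ʳ ys (here refl)))

sum-take-sort-≤ : ∀ xs ys {zs} → xs ↭ ys ++ zs → sum (take (length ys) (sort xs)) ≤ sum ys
sum-take-sort-≤ xs ys xs↭ =
  sum-take-sorted-≤ {ys = ys} (Linked⇒AllPairs ≤-trans (sort-↗ xs)) refl (↭-trans (sort-↭ xs) xs↭)

⟦_⟧ : Bool → ℕ
⟦ b ⟧ = if b then 1 else 0

sumWhere : ∀ {n} → (Fin n → Bool) → (Fin n → ℕ) → ℕ
sumWhere c f = sumFin (λ i → if c i then f i else 0)

sumFin² : ∀ {n} → (Fin n → Fin n → ℕ) → ℕ
sumFin² f = sumFin (λ i → sumFin (f i))

sumFin-cong : ∀ {n} {f g : Fin n → ℕ} → (∀ i → f i ≡ g i) → sumFin f ≡ sumFin g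
sumFin-cong {zero}  f≡g = refl
sumFin-cong {suc n} f≡g = cong₂ _+_ (f≡g zero) (sumFin-cong (f≡g ∘ suc))

sumFin-mono : ∀ {n} {f g : Fin n → ℕ} → (∀ i → f i ≤ g i) → sumFin f ≤ sumFin g
sumFin-mono {zero}  f≤g = z≤n
sumFin-mono {suc n} f≤g = +-mono-≤ (f≤g zero) (sumFin-mono (f≤g ∘ suc))

sumFin-zero : ∀ n → sumFin {n} (λ _ → 0) ≡ 0
sumFin-zero zero    = refl
sumFin-zero (suc n) = sumFin-zero n

sumFin-+ : ∀ {n} (f g : Fin n → ℕ) → sumFin (λ i → f i + g i) ≡ sumFin f + sumFin g
sumFin-+ {zero}  f g = refl
sumFin-+ {suc n} f g = trans (cong (f zero + g zero +_) (sumFin-+ (f ∘ suc) (g ∘ suc)))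
  (+-interchange (f zero) (g zero) (sumFin (f ∘ suc)) (sumFin (g ∘ suc)))

sumFin-swap : ∀ {m n} (f : Fin m → Fin n → ℕ) →
  sumFin (λ i → sumFin (f i)) ≡ sumFin (λ j → sumFin (λ i → f i j))
sumFin-swap {zero}  {n} f = sym (sumFin-zero n)
sumFin-swap {suc m}     f = trans (cong (sumFin (f zero) +_) (sumFin-swap (f ∘ suc)))
  (sym (sumFin-+ (f zero) (λ j → sumFin (λ i → f (suc i) j))))

sumFin²-+-transpose : ∀ {n} (f : Fin n → Fin n → ℕ) →
  sumFin² (λ i j → f i j + f j i) ≡ sumFin² f + sumFin² f
sumFin²-+-transpose f = begin
  sumFin² (λ i j → f i j + f j i)
    ≡⟨ sumFin-cong (λ i → sumFin-+ (f i) (λ j → f j i)) ⟩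
  sumFin (λ i → sumFin (f i) + sumFin (λ j → f j i))
    ≡⟨ sumFin-+ (λ i → sumFin (f i)) (λ i → sumFin (λ j → f j i)) ⟩
  sumFin² f + sumFin² (λ i j → f j i)
    ≡⟨ cong (sumFin² f +_) (sumFin-swap (λ i j → f j i)) ⟩
  sumFin² f + sumFin² f ∎
  where open ≡-Reasoning

sumFin²-transpose-invariant : ∀ {n} (f g : Fin n → Fin n → ℕ) →
  (∀ i j → f i j + f j i ≡ g i j + g j i) → sumFin² f ≡ sumFin² g
sumFin²-transpose-invariant f g f+fᵀ≡g+gᵀ = *-cancelˡ-≡ _ _ 2 (begin
  2 * sumFin² f                    ≡⟨ doubling (sumFin² f) ⟨
  sumFin² f + sumFin² f            ≡⟨ sumFin²-+-transpose f ⟨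
  sumFin² (λ i j → f i j + f j i)  ≡⟨ sumFin-cong (λ i → sumFin-cong (f+fᵀ≡g+gᵀ i)) ⟩
  sumFin² (λ i j → g i j + g j i)  ≡⟨ sumFin²-+-transpose g ⟩
  sumFin² g + sumFin² g            ≡⟨ doubling (sumFin² g) ⟩
  2 * sumFin² g                    ∎)
  where
  open ≡-Reasoning
  doubling : ∀ m → m + m ≡ 2 * m
  doubling m = cong (m +_) (sym (+-identityʳ m))

count≡sumFin : ∀ {n} (P : Fin n → Bool) → count P ≡ sumFin (⟦_⟧ ∘ P)
count≡sumFin {zero}  P = refl
count≡sumFin {suc n} P = cong (⟦ P zero ⟧ +_) (count≡sumFin (P ∘ suc))

count-pos : ∀ {n} (P : Fin n → Bool) i → P i ≡ true → 0 < count P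
count-pos P zero    Pi = subst (λ b → 0 < ⟦ b ⟧ + count (P ∘ suc)) (sym Pi) (s≤s z≤n)
count-pos P (suc i) Pi = ≤-trans (count-pos (P ∘ suc) i Pi) (m≤n+m _ ⟦ P zero ⟧)

⟦⟧-mono : ∀ {p q} → (p ≡ true → q ≡ true) → ⟦ p ⟧ ≤ ⟦ q ⟧
⟦⟧-mono {false} _   = z≤n
⟦⟧-mono {true}  p⇒q rewrite p⇒q refl = ≤-refl

count-mono : ∀ {n} (P Q : Fin n → Bool) → (∀ j → P j ≡ true → Q j ≡ true) → count P ≤ count Q
count-mono {zero}  P Q P⇒Q = z≤n
count-mono {suc n} P Q P⇒Q = +-mono-≤ (⟦⟧-mono (P⇒Q zero)) (count-mono (P ∘ suc) (Q ∘ suc) (P⇒Q ∘ suc))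

count-< : ∀ {n} (P Q : Fin n → Bool) → (∀ j → P j ≡ true → Q j ≡ true) →
  ∀ i → P i ≡ false → Q i ≡ true → count P < count Q
count-< P Q P⇒Q zero    Pi Qi rewrite Pi | Qi = s≤s (count-mono (P ∘ suc) (Q ∘ suc) (P⇒Q ∘ suc))
count-< P Q P⇒Q (suc i) Pi Qi = ≤-trans (≤-reflexive (sym (+-suc ⟦ P zero ⟧ _)))
  (+-mono-≤ (⟦⟧-mono (P⇒Q zero)) (count-< (P ∘ suc) (Q ∘ suc) (P⇒Q ∘ suc) i Pi Qi))

count-∧-split : ∀ {n} (P Q : Fin n → Bool) →
  count P ≡ count (λ j → P j ∧ Q j) + count (λ j → P j ∧ not (Q j))
count-∧-split {zero}  P Q = refl
count-∧-split {suc n} P Q with P zero | Q zero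
... | false | _     = count-∧-split (P ∘ suc) (Q ∘ suc)
... | true  | true  = cong suc (count-∧-split (P ∘ suc) (Q ∘ suc))
... | true  | false = trans (cong suc (count-∧-split (P ∘ suc) (Q ∘ suc))) (sym (+-suc _ _))

count-pos⇒∃ : ∀ {n} (c : Fin n → Bool) → 0 < count c → ∃ λ i → c i ≡ true
count-pos⇒∃ {suc n} c 0<count with c zero in c₀
... | true  = zero , c₀
... | false with i , ci ← count-pos⇒∃ (c ∘ suc) 0<count = suc i , ci

count<⇒∃ : ∀ {n} (c : Fin n → Bool) → count c < n → ∃ λ i → c i ≡ false
count<⇒∃ {suc n} c count<n with c zero in c₀
... | false = zero , c₀
... | true with i , ci ← count<⇒∃ (c ∘ suc) (≤-pred count<n) = suc i , ci

sumWhere-term : ∀ {n} (c : Fin n → Bool) (f : Fin n → ℕ) i → c i ≡ true → f i ≤ sumWhere c f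
sumWhere-term c f zero    ci rewrite ci = m≤m+n _ _
sumWhere-term c f (suc i) ci = ≤-trans (sumWhere-term (c ∘ suc) (f ∘ suc) i ci) (m≤n+m _ _)

sumWhere-mono : ∀ {n} (c : Fin n → Bool) {f g : Fin n → ℕ} →
  (∀ i → c i ≡ true → f i ≤ g i) → sumWhere c f ≤ sumWhere c g
sumWhere-mono c f≤g = sumFin-mono pointwise
  where
  pointwise : ∀ i → (if c i then _ else 0) ≤ (if c i then _ else 0)
  pointwise i with c i in ci
  ... | true  = f≤g i ci
  ... | false = z≤n

sumWhere-+ : ∀ {n} (c : Fin n → Bool) (f g : Fin n → ℕ) →
  sumWhere c (λ i → f i + g i) ≡ sumWhere c f + sumWhere c g
sumWhere-+ c f g = trans (sumFin-cong pointwise)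
  (sumFin-+ (λ i → if c i then f i else 0) (λ i → if c i then g i else 0))
  where
  pointwise : ∀ i → (if c i then f i + g i else 0) ≡ (if c i then f i else 0) + (if c i then g i else 0)
  pointwise i with c i
  ... | true  = refl
  ... | false = refl

sumWhere-const : ∀ {n} (c : Fin n → Bool) k → sumWhere c (λ _ → k) ≡ count c * k
sumWhere-const {zero}  c k = refl
sumWhere-const {suc n} c k with c zero
... | true  = cong (k +_) (sumWhere-const (c ∘ suc) k)
... | false = sumWhere-const (c ∘ suc) k

select : ∀ {n} → (Fin n → Bool) → (Fin n → ℕ) → List ℕ
select {zero}  c f = []
select {suc n} c f = if c zero then f zero ∷ rest else rest
  where rest = select (c ∘ suc) (f ∘ suc)

tabulate-↭-select : ∀ {n} (c : Fin n → Bool) f → tabulate f ↭ select c f ++ select (not ∘ c) f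
tabulate-↭-select {zero}  c f = ↭-refl
tabulate-↭-select {suc n} c f with c zero
... | true  = prep (f zero) (tabulate-↭-select (c ∘ suc) (f ∘ suc))
... | false = ↭-trans (prep (f zero) (tabulate-↭-select (c ∘ suc) (f ∘ suc)))
                      (↭-sym (shift (f zero) (select (c ∘ suc) (f ∘ suc)) _))

length-select : ∀ {n} (c : Fin n → Bool) f → length (select c f) ≡ count c
length-select {zero}  c f = refl
length-select {suc n} c f with c zero
... | true  = cong suc (length-select (c ∘ suc) (f ∘ suc))
... | false = length-select (c ∘ suc) (f ∘ suc)

sum-select : ∀ {n} (c : Fin n → Bool) f → sum (select c f) ≡ sumWhere c f
sum-select {zero}  c f = refl
sum-select {suc n} c f with c zero
... | true  = cong (f zero +_) (sum-select (c ∘ suc) (f ∘ suc))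
... | false = sum-select (c ∘ suc) (f ∘ suc)

sum-take-sort-≤-sumWhere : ∀ {n} (c : Fin n → Bool) (f : Fin n → ℕ) →
  sum (take (count c) (sort (map f (allFin n)))) ≤ sumWhere c f
sum-take-sort-≤-sumWhere {n} c f = begin
  sum (take (count c) (sort (map f (allFin n))))
    ≡⟨ cong (λ k → sum (take k (sort (map f (allFin n))))) (length-select c f) ⟨
  sum (take (length (select c f)) (sort (map f (allFin n))))
    ≤⟨ sum-take-sort-≤ (map f (allFin n)) (select c f)
         (subst (_↭ select c f ++ select (not ∘ c) f) (sym (map-tabulate (λ i → i) f))
                (tabulate-↭-select c f)) ⟩
  sum (select c f)
    ≡⟨ sum-select c f ⟩
  sumWhere c f ∎
  where open ≤-Reasoning

<ᵇ-true : ∀ {m n} → m < n → (m <ᵇ n) ≡ true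
<ᵇ-true (s≤s z≤n)       = refl
<ᵇ-true (s≤s (s≤s m<n)) = <ᵇ-true (s≤s m<n)

<ᵇ-false : ∀ {m n} → n ≤ m → (m <ᵇ n) ≡ false
<ᵇ-false z≤n       = refl
<ᵇ-false (s≤s n≤m) = <ᵇ-false n≤m

cut-pair : ∀ a x y → ⟦ x ∧ (a ∧ not y) ⟧ + ⟦ y ∧ (a ∧ not x) ⟧ ≡ ⟦ a ∧ (x xor y) ⟧
cut-pair false false false = refl
cut-pair false false true  = refl
cut-pair false true  false = refl
cut-pair false true  true  = refl
cut-pair true  false false = refl
cut-pair true  false true  = refl
cut-pair true  true  false = refl
cut-pair true  true  true  = refl

module _ {N : ℕ} (G : SimpleGraph N) where

  degreeTo : (Fin N → Bool) → Fin N → ℕ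
  degreeTo P i = count (λ j → adj G i j ∧ P j)

  edgesLeaving : (Fin N → Bool) → ℕ
  edgesLeaving c = sumWhere c (degreeTo (not ∘ c))

  module _ (c : Fin N → Bool) where

    private
      ordered : Fin N → Fin N → Bool
      ordered i j = if toℕ i <ᵇ toℕ j then adj G i j ∧ (c i xor c j) else false

      leaving : Fin N → Fin N → Bool
      leaving i j = c i ∧ (adj G i j ∧ not (c j))

      leaving≈ordered : ∀ i j → ⟦ leaving i j ⟧ + ⟦ leaving j i ⟧ ≡ ⟦ ordered i j ⟧ + ⟦ ordered j i ⟧
      leaving≈ordered i j rewrite SimpleGraph.sym G j i with <-cmp (toℕ i) (toℕ j)
      ... | tri< i<j _ _ rewrite <ᵇ-true i<j | <ᵇ-false (<⇒≤ i<j) =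
        trans (cut-pair (adj G i j) (c i) (c j)) (sym (+-identityʳ _))
      ... | tri> _ _ j<i rewrite <ᵇ-false (<⇒≤ j<i) | <ᵇ-true j<i =
        trans (cut-pair (adj G i j) (c i) (c j)) (cong (⟦_⟧ ∘ (adj G i j ∧_)) (xor-comm (c i) (c j)))
      ... | tri≈ _ i≡j _ with refl ← toℕ-injective i≡j rewrite <ᵇ-false (≤-refl {toℕ i}) | irrefl G i =
        cut-pair false (c i) (c i)

    -- m₁₀ counts a cut edge at the pair (i, j) with i < j, edgesLeaving at the
    -- pair whose first node has c = 1; the two summands agree after symmetrising.
    m10≡edgesLeaving : m10 G c ≡ edgesLeaving c
    m10≡edgesLeaving = begin
      m10 G c                            ≡⟨ sumFin-cong (λ i → count≡sumFin (ordered i)) ⟩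
      sumFin² (λ i j → ⟦ ordered i j ⟧)  ≡⟨ sumFin²-transpose-invariant _ _ (λ i j → sym (leaving≈ordered i j)) ⟩
      sumFin² (λ i j → ⟦ leaving i j ⟧)  ≡⟨ sumFin-cong row ⟩
      edgesLeaving c                     ∎
      where
      open ≡-Reasoning
      row : ∀ i → sumFin (λ j → ⟦ leaving i j ⟧) ≡ (if c i then degreeTo (not ∘ c) i else 0)
      row i with c i
      ... | true  = sym (count≡sumFin (λ j → adj G i j ∧ not (c j)))
      ... | false = sumFin-zero N

    degree≡degreeTo+degreeTo : ∀ i → degree G i ≡ degreeTo c i + degreeTo (not ∘ c) i
    degree≡degreeTo+degreeTo i = count-∧-split (adj G i) c

    degreeTo-self-< : ∀ i → c i ≡ true → degreeTo c i < count c
    degreeTo-self-< i ci = count-< _ c (λ j → ∧-conicalʳ (adj G i j) (c j)) i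
      (cong (_∧ c i) (irrefl G i)) ci

    sumWhere-degree-≤ : sumWhere c (degree G) ≤ count c * (count c ∸ 1) + edgesLeaving c
    sumWhere-degree-≤ = begin
      sumWhere c (degree G)
        ≡⟨ sumFin-cong (λ i → cong (if c i then_else 0) (degree≡degreeTo+degreeTo i)) ⟩
      sumWhere c (λ i → degreeTo c i + degreeTo (not ∘ c) i)
        ≡⟨ sumWhere-+ c (degreeTo c) (degreeTo (not ∘ c)) ⟩
      sumWhere c (degreeTo c) + edgesLeaving c
        ≤⟨ +-monoˡ-≤ (edgesLeaving c) (sumWhere-mono c (λ i ci → ∸-monoˡ-≤ 1 (degreeTo-self-< i ci))) ⟩
      sumWhere c (λ _ → count c ∸ 1) + edgesLeaving c
        ≡⟨ cong (_+ edgesLeaving c) (sumWhere-const c (count c ∸ 1)) ⟩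
      count c * (count c ∸ 1) + edgesLeaving c ∎
      where open ≤-Reasoning

    crossing-edge : ∀ {i j} → Reachable G i j → c i ≡ true → c j ≡ false →
      Σ (Fin N × Fin N) λ (a , b) → adj G a b ≡ true × c a ≡ true × c b ≡ false
    crossing-edge here ci cj with () ← trans (sym ci) cj
    crossing-edge {i} (step {j = k} aik k⇝j) ci cj with c k in ck
    ... | true  = crossing-edge k⇝j ck cj
    ... | false = (i , k) , aik , ci , ck

    edgesLeaving-pos : Connected G → 0 < count c → count c < N → 0 < edgesLeaving c
    edgesLeaving-pos conn 0<count count<N
      with i , ci ← count-pos⇒∃ c 0<count | j , cj ← count<⇒∃ c count<N
      with (a , b) , aab , ca , cb ← crossing-edge (conn i j) ci cj =
      ≤-trans (count-pos _ b b-counted) (sumWhere-term c (degreeTo (not ∘ c)) a ca)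
      where
      b-counted : adj G a b ∧ not (c b) ≡ true
      b-counted rewrite aab | cb = refl

sumSmallestDegrees-≤ : ∀ {N} (G : SimpleGraph N) (c : Fin N → Bool) {n₁} → count c ≡ n₁ →
  sumSmallestDegrees G n₁ ≤ n₁ * (n₁ ∸ 1) + edgesLeaving G c
sumSmallestDegrees-≤ G c refl =
  ≤-trans (sum-take-sort-≤-sumWhere c (degree G)) (sumWhere-degree-≤ G c)

proposition3p4 : (N : ℕ) (G : SimpleGraph N) → Connected G →
    (n₁ : ℕ) → n₁ ≤ N → (c : Fin N → Bool) → count (λ i → c i) ≡ n₁ →
      m10 G c ≥ LBm10 G n₁
proposition3p4 N G conn zero _ c _ = z≤n
proposition3p4 N G conn n₁@(suc _) _ c |c| with N ≤ᵇ n₁ in N≤ᵇn₁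
... | true  = z≤n
... | false rewrite m10≡edgesLeaving G c =
  ⊔-lub (edgesLeaving-pos G c conn 0<count count<N)
        (m≤n+o⇒m∸n≤o _ (n₁ * (n₁ ∸ 1)) (sumSmallestDegrees-≤ G c |c|))
  where
  0<count : 0 < count c
  0<count = subst (0 <_) (sym |c|) (s≤s z≤n)
  count<N : count c < N
  count<N = subst (_< N) (sym |c|) (≰⇒> (λ N≤n₁ → subst T N≤ᵇn₁ (≤⇒≤ᵇ N≤n₁)))
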